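{- Let $G=U(T_1,\dots,T_g)$ be a unicyclic graph of order $n$ with girth $g$, and let $p\ne q$. Suppose $|V(T_p)|\ge3$, $|V(T_q)|\ge3$, $x$ is a leaf of $T_p$ adjacent to $u_p$, and $y$ is a leaf of $T_q$ adjacent to $u_q$. Let $T_p^{(1)}$ be the tree obtained from $T_p$ and $T_q$ by identifying $u_p$ and $u_q$ (into the vertex $u_p$) and deleting the edge $u_qy$ (with $y$), and let $T_q^{(1)}$ be the edge $u_qy$. Let $T_p^{(2)}$ be the edge $u_px$, and let $T_q^{(2)}$ be the tree obtained from $T_p$ and $T_q$ by identifying $u_p$ and $u_q$ (into the vertex $u_q$) and deleting the edge $u_px$ (with $x$). For $i=1,2$ let $G_i$ be obtained from $G$ by replacing the branches $T_p,T_q$ with $T_p^{(i)}$ at $u_p$ and $T_q^{(i)}$ at $u_q$. Then $G$, $G_1$, $G_2$ have the same matching number and $$W(G)>\min\{W(G_1),W(G_2)\}.$$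
   Context: All graphs are finite, simple, undirected. $W(H)=\sum_{\{u,v\}\subseteq V(H)} d_H(u,v)$ is the Wiener index, $d_H$ the distance. The matching number is the maximum size of a matching. A unicyclic graph is a connected graph with exactly one cycle, its girth the cycle length. If $C_g=u_1\cdots u_g$ is the cycle of $G$, $G-E(C_g)$ consists of trees $T_1,\dots,T_g$ with $u_i\in V(T_i)$ (the branch at $u_i$) and we write $G=U(T_1,\dots,T_g)$. -}

module Defs where

open import Data.Bool using (Bool; true; false; _∧_; _∨_; not; if_then_else_)
open import Data.Nat using (ℕ; zero; suc; _+_; _∸_; _≤_; _<_; _≡ᵇ_; _<ᵇ_)
open import Data.Fin using (Fin; toℕ)
open import Data.Fin.Properties using () renaming (_≟_ to _≟F_)
open import Data.List using (List; map)
open import Data.Nat.ListAction using (sum)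
open import Data.Bool.ListAction using (any)
open import Data.List using (allFin) public
open import Data.Product using (Σ; _×_; _,_; proj₁; proj₂)
open import Relation.Nullary using (¬_)
open import Relation.Nullary.Decidable using (⌊_⌋)
open import Relation.Binary.PropositionalEquality using (_≡_; _≢_)

Graph : ℕ → Set
Graph n = Fin n → Fin n → Bool

IsSimple : ∀ {n} → Graph n → Set
IsSimple {n} A = (∀ (a b : Fin n) → A a b ≡ A b a) × (∀ (a : Fin n) → A a a ≡ false)

_==_ : ∀ {n} → Fin n → Fin n → Bool
a == b = ⌊ a ≟F b ⌋

Σv : ∀ {n} → (Fin n → ℕ) → ℕ
Σv {n} f = sum (map f (allFin n))

count : ∀ {n} → (Fin n → Bool) → ℕ
count P = Σv (λ v → if P v then 1 else 0)

reach : ∀ {n} → Graph n → ℕ → Fin n → Fin n → Bool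
reach {n} A zero    u v = u == v
reach {n} A (suc k) u v = reach A k u v ∨ any (λ w → reach A k u w ∧ A w v) (allFin n)

Connected : ∀ {n} → Graph n → Set
Connected {n} A = ∀ (u v : Fin n) → Σ ℕ (λ k → reach A k u v ≡ true)

-- least k < bound with f k = true (bound if there is none)
firstTrue : ℕ → (ℕ → Bool) → ℕ
firstTrue zero      f = zero
firstTrue (suc b)   f = if f zero then zero else suc (firstTrue b (λ k → f (suc k)))

-- distance d_A(u,v): least length of a walk (equivalently path) from u to v.
-- In a connected graph on n vertices it is < n, so searching below n suffices.
dist : ∀ {n} → Graph n → Fin n → Fin n → ℕ
dist {n} A u v = firstTrue n (λ k → reach A k u v)

W : ∀ {n} → Graph n → ℕ
W A = Σv (λ u → Σv (λ v → if toℕ u <ᵇ toℕ v then dist A u v else 0))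

edgeCount : ∀ {n} → Graph n → ℕ
edgeCount A = Σv (λ u → Σv (λ v → if (toℕ u <ᵇ toℕ v) ∧ A u v then 1 else 0))

IsMatching : ∀ {n k} → Graph n → (Fin k → Fin n × Fin n) → Set
IsMatching {n} {k} A M =
  (∀ (i : Fin k) → A (proj₁ (M i)) (proj₂ (M i)) ≡ true) ×
  (∀ (i j : Fin k) → i ≢ j →
     (proj₁ (M i) ≢ proj₁ (M j)) × (proj₁ (M i) ≢ proj₂ (M j)) ×
     (proj₂ (M i) ≢ proj₁ (M j)) × (proj₂ (M i) ≢ proj₂ (M j)))

HasMatching : ∀ {n} → Graph n → ℕ → Set
HasMatching {n} A k = Σ (Fin k → Fin n × Fin n) (λ M → IsMatching A M)

IsMatchingNumber : ∀ {n} → Graph n → ℕ → Set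
IsMatchingNumber A k = HasMatching A k × (∀ m → HasMatching A m → m ≤ k)

consec : ∀ {g} → Fin g → Fin g → Bool
consec {g} i j = (suc (toℕ i) ≡ᵇ toℕ j) ∨ ((toℕ i ≡ᵇ g ∸ 1) ∧ (toℕ j ≡ᵇ 0))

IsCycle : ∀ {n g} → Graph n → (Fin g → Fin n) → Set
IsCycle {n} {g} A c =
  (3 ≤ g) × (∀ (i j : Fin g) → c i ≡ c j → i ≡ j) ×
  (∀ (i j : Fin g) → consec i j ≡ true → A (c i) (c j) ≡ true)

-- A is a unicyclic graph (connected, exactly one cycle) whose cycle is c
-- (for a connected simple graph on n vertices: exactly one cycle ⇔ n edges;
-- the cycle is then c)
Unicyclic : ∀ {n g} → Graph n → (Fin g → Fin n) → Set
Unicyclic {n} A c = IsSimple A × Connected A × (edgeCount A ≡ n) × IsCycle A c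

cycleEdge : ∀ {n g} → (Fin g → Fin n) → Fin n → Fin n → Bool
cycleEdge {n} {g} c a b =
  any (λ i → any (λ j → consec i j ∧ (((c i == a) ∧ (c j == b)) ∨ ((c i == b) ∧ (c j == a))))
                 (allFin g)) (allFin g)

forest : ∀ {n g} → Graph n → (Fin g → Fin n) → Graph n
forest A c a b = A a b ∧ not (cycleEdge c a b)

-- v ∈ V(T_i): v lies in the component of G - E(C_g) containing u_i = c i
inBranch : ∀ {n g} → Graph n → (Fin g → Fin n) → Fin g → Fin n → Bool
inBranch {n} A c i v = reach (forest A c) n (c i) v

branchSize : ∀ {n g} → Graph n → (Fin g → Fin n) → Fin g → ℕ
branchSize A c i = count (inBranch A c i)

forestDeg : ∀ {n g} → Graph n → (Fin g → Fin n) → Fin n → ℕ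
forestDeg A c v = count (forest A c v)

LeafAt : ∀ {n g} → Graph n → (Fin g → Fin n) → Fin g → Fin n → Set
LeafAt A c i x = (inBranch A c i x ≡ true) × (forestDeg A c x ≡ 1) × (A (c i) x ≡ true)

-- Transplant: the branch T_s at u_s = c s (of size ≥ 3, with leaf z adjacent to u_s)
-- is merged into the branch at u_t = c t by identifying u_s with u_t into u_t,
-- except that the pendant edge u_s z stays at u_s.  On the common vertex set
-- Fin n this replaces every edge u_s w (w ∈ V(T_s) ∖ {u_s, z}) by u_t w.
transplant : ∀ {n g} → Graph n → (Fin g → Fin n) → (s t : Fin g) → Fin n → Graph n
transplant A c s t z a b =
  if ((a == us) ∧ moved b) ∨ ((b == us) ∧ moved a) then false
  else if (a == ut) ∧ moved b then A us b
  else if (b == ut) ∧ moved a then A a us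
  else A a b
  where
  us = c s
  ut = c t
  moved : _ → Bool
  moved w = inBranch A c s w ∧ not (w == us) ∧ not (w == z)

-- G₁: T_p^{(1)} = T_p with T_q - y glued at u_p, T_q^{(1)} = edge u_q y
G₁ : ∀ {n g} → Graph n → (Fin g → Fin n) → (p q : Fin g) → (x y : Fin n) → Graph n
G₁ A c p q x y = transplant A c q p y

-- G₂: T_p^{(2)} = edge u_p x, T_q^{(2)} = T_q with T_p - x glued at u_q
G₂ : ∀ {n g} → Graph n → (Fin g → Fin n) → (p q : Fin g) → (x y : Fin n) → Graph n
G₂ A c p q x y = transplant A c p q x

-- G₁ and G₂ arise from G by moving a pendant set S = V(T_s) ∖ {u_s, z} (z the given leaf) from
-- the cycle vertex u_s to u_t.  In a unicyclic graph with n edges no forest path joins two cycle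
-- vertices (it would yield n + 1 distinct edges), so S meets the rest of G only through u_s.
-- Hence distances within S and within its complement are unchanged, while for a ∈ S, b ∉ S the
-- distance d(a,u_s) + d(u_s,b) becomes d(a,u_s) + d(u_t,b): W changes by |S| times the difference
-- of the distance sums from u_t and from u_s to the vertices outside S.  With P, Q the pendant sets
-- at u_p, u_q, R the remaining vertices and α, β the distance sums from u_p, u_q to R, this gives
--   W(G₂) − W(G) = |P| (β − α − |Q| d(u_p,u_q)),   W(G₁) − W(G) = |Q| (α − β − |P| d(u_p,u_q)),
-- so one of them is negative.  A matching transfers in both directions by replacing its edge at
-- u_p by u_p x and its edge at u_q by u_q y, so the matching number is unchanged.

{-# OPTIONS --safe #-}
module Submission where

open import Defs
open import Data.Bool using (Bool; true; false; _∧_; _∨_; not; if_then_else_)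
open import Data.Bool.Properties
  using (∧-conicalˡ; ∧-conicalʳ; ∧-zeroʳ; ∧-identityʳ; ∨-comm; T-≡; not-¬; not-involutive)
  renaming (_≟_ to _≟ᵇ_)
open import Data.Nat using (ℕ; zero; suc; _+_; _*_; _∸_; _≤_; _<_; _<?_; _<ᵇ_; _≡ᵇ_; z≤n; s≤s; _⊓_; >-nonZero)
open import Data.Nat.Properties
open import Data.Fin using (Fin; toℕ; zero; suc; fromℕ<)
open import Data.Fin.Properties using (all?; ¬∀⟶∃¬; toℕ-injective; toℕ-fromℕ<; toℕ<n)
  renaming (_≟_ to _≟F_; suc-injective to Fin-suc-injective)
open import Data.List using ([]; _∷_; tabulate)
open import Data.List.Properties using (map-tabulate)
import Data.Nat.ListAction as ℕ-List
open import Data.Bool.ListAction using (any)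
open import Data.List.Relation.Unary.Any as Any using (satisfied)
open import Data.List.Relation.Unary.Any.Properties using (any⁺; any⁻)
open import Data.List.Membership.Propositional.Properties using (∈-allFin)
open import Data.Product using (∃-syntax; _×_; _,_; proj₁; proj₂; uncurry; swap)
open import Data.Product.Properties using (,-injective)
open import Data.Sum using (_⊎_; inj₁; inj₂)
open import Data.Empty using (⊥; ⊥-elim)
open import Function using (_∘_; id; Equivalence)
open import Relation.Binary.Definitions using (tri<; tri≈; tri>)
open import Relation.Nullary using (¬_; yes; no; Dec; contradiction)
open import Relation.Binary.PropositionalEquality
  using (_≡_; _≢_; refl; sym; trans; cong; cong₂; subst; subst₂; module ≡-Reasoning)
open import Algebra.Properties.CommutativeSemigroup +-commutativeSemigroup using (interchange; xy∙z≈xz∙y)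
open import Algebra.Properties.Semiring.Sum +-*-semiring
  using (sum; sum-cong-≗; sum-replicate-zero; ∑-distrib-+; ∑-comm)

true≢false : true ≢ false
true≢false ()

==-refl : ∀ {n} (a : Fin n) → (a == a) ≡ true
==-refl a with a ≟F a
... | yes _  = refl
... | no a≢a = contradiction refl a≢a

==⇒≡ : ∀ {n} {a b : Fin n} → (a == b) ≡ true → a ≡ b
==⇒≡ {a = a} {b} e with a ≟F b
... | yes a≡b = a≡b

≢⇒==≡false : ∀ {n} {a b : Fin n} → a ≢ b → (a == b) ≡ false
≢⇒==≡false {a = a} {b} a≢b with a ≟F b
... | yes a≡b = contradiction a≡b a≢b
... | no _    = refl

==≡false⇒≢ : ∀ {n} {a b : Fin n} → (a == b) ≡ false → a ≢ b
==≡false⇒≢ e refl = not-¬ (==-refl _) e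

not≡true : ∀ {x} → not x ≡ true → x ≡ false
not≡true {false} _ = refl

any-witness : ∀ {n} (p : Fin n → Bool) → any p (allFin n) ≡ true → ∃[ i ] p i ≡ true
any-witness {n} p e with satisfied (any⁻ p (allFin n) (Equivalence.from T-≡ e))
... | i , pi = i , Equivalence.to T-≡ pi

any-intro : ∀ {n} (p : Fin n → Bool) (i : Fin n) → p i ≡ true → any p (allFin n) ≡ true
any-intro p i e = Equivalence.to T-≡ (any⁺ p (Any.map (λ { refl → Equivalence.from T-≡ e }) (∈-allFin i)))

any-cong : ∀ {A : Set} {p q : A → Bool} → (∀ a → p a ≡ q a) → ∀ xs → any p xs ≡ any q xs
any-cong p≗q []       = refl
any-cong p≗q (x ∷ xs) = cong₂ _∨_ (p≗q x) (any-cong p≗q xs)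

𝟙 : Bool → ℕ
𝟙 b = if b then 1 else 0

card : ∀ {n} → (Fin n → Bool) → ℕ
card P = sum (λ v → 𝟙 (P v))

Σv≡sum : ∀ {n} (f : Fin n → ℕ) → Σv f ≡ sum f
Σv≡sum {n} f = trans (cong ℕ-List.sum (map-tabulate id f)) (sum-tabulate f)
  where
  sum-tabulate : ∀ {m} (h : Fin m → ℕ) → ℕ-List.sum (tabulate h) ≡ sum h
  sum-tabulate {zero}  h = refl
  sum-tabulate {suc m} h = cong (h zero +_) (sum-tabulate (h ∘ suc))

count≡card : ∀ {n} (P : Fin n → Bool) → count P ≡ card P
count≡card P = Σv≡sum (λ v → 𝟙 (P v))

sum-mono-≤ : ∀ {n} {f g : Fin n → ℕ} → (∀ i → f i ≤ g i) → sum f ≤ sum g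
sum-mono-≤ {zero}  f≤g = z≤n
sum-mono-≤ {suc n} f≤g = +-mono-≤ (f≤g zero) (sum-mono-≤ (f≤g ∘ suc))

sum-mono-< : ∀ {n} {f g : Fin n → ℕ} → (∀ i → f i ≤ g i) → ∀ j → f j < g j → sum f < sum g
sum-mono-< f≤g zero    fj<gj = +-mono-<-≤ fj<gj (sum-mono-≤ (f≤g ∘ suc))
sum-mono-< f≤g (suc j) fj<gj = +-mono-≤-< (f≤g zero) (sum-mono-< (f≤g ∘ suc) j fj<gj)

𝟙-mono : ∀ {x y} → (x ≡ true → y ≡ true) → 𝟙 x ≤ 𝟙 y
𝟙-mono {false} x⇒y = z≤n
𝟙-mono {true}  x⇒y rewrite x⇒y refl = ≤-refl

card-mono : ∀ {n} {P Q : Fin n → Bool} → (∀ v → P v ≡ true → Q v ≡ true) → card P ≤ card Q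
card-mono P⊆Q = sum-mono-≤ (λ v → 𝟙-mono (P⊆Q v))

card-≤ : ∀ {n} (P : Fin n → Bool) → card P ≤ n
card-≤ {zero}  P = z≤n
card-≤ {suc n} P = +-mono-≤ (𝟙-mono {P zero} {true} (λ _ → refl)) (card-≤ (P ∘ suc))

card-full : ∀ {n} (P : Fin n → Bool) → n ≤ card P → ∀ v → P v ≡ true
card-full {suc n} P full v with P zero in P₀
... | false = contradiction full (<⇒≱ (s≤s (card-≤ (P ∘ suc))))
card-full {suc n} P full zero    | true = P₀
card-full {suc n} P full (suc v) | true = card-full (P ∘ suc) (≤-pred full) v

suc-== : ∀ {n} (v a : Fin n) → (suc v == suc a) ≡ (v == a)
suc-== v a with v ≟F a
... | yes _ = refl
... | no _  = refl

card-singleton : ∀ {n} (a : Fin n) → card (_== a) ≡ 1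
card-singleton {suc n} zero    = cong suc (sum-replicate-zero n)
card-singleton {suc n} (suc a) = trans (sum-cong-≗ (λ v → cong 𝟙 (suc-== v a))) (card-singleton a)

card-nonempty : ∀ {n} (P : Fin n → Bool) {a} → P a ≡ true → 1 ≤ card P
card-nonempty P {a} Pa =
  subst (_≤ card P) (card-singleton a) (card-mono {P = _== a} (λ v v=a → subst (λ w → P w ≡ true) (sym (==⇒≡ v=a)) Pa))

card-pair : ∀ {n} (P : Fin n → Bool) {a b} → P a ≡ true → P b ≡ true → a ≢ b → 2 ≤ card P
card-pair {n} P {a} {b} Pa Pb a≢b = begin
  2                                          ≡⟨ cong₂ _+_ (card-singleton a) (card-singleton b) ⟨
  card (_== a) + card (_== b)                ≡⟨ ∑-distrib-+ {n} (λ v → 𝟙 (v == a)) (λ v → 𝟙 (v == b)) ⟨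
  sum (λ v → 𝟙 (v == a) + 𝟙 (v == b))        ≤⟨ sum-mono-≤ pointwise ⟩
  card P                                     ∎
  where
  open ≤-Reasoning
  pointwise : ∀ v → 𝟙 (v == a) + 𝟙 (v == b) ≤ 𝟙 (P v)
  pointwise v with v ≟F a | v ≟F b
  ... | yes refl | yes refl = contradiction refl a≢b
  ... | yes refl | no _     rewrite Pa = ≤-refl
  ... | no _     | yes refl rewrite Pb = ≤-refl
  ... | no _     | no _     = z≤n

IsSymmetric : ∀ {n} → Graph n → Set
IsSymmetric {n} H = ∀ (a b : Fin n) → H a b ≡ H b a

data Reach {n} (H : Graph n) : ℕ → Fin n → Fin n → Set where
  here : ∀ {k a} → Reach H k a a
  step : ∀ {k a w b} → Reach H k a w → H w b ≡ true → Reach H (suc k) a b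

module _ {n} {H : Graph n} where

  Reach-suc : ∀ {k a b} → Reach H k a b → Reach H (suc k) a b
  Reach-suc here       = here
  Reach-suc (step r e) = step (Reach-suc r) e

  Reach-≤ : ∀ {k m a b} → k ≤ m → Reach H k a b → Reach H m a b
  Reach-≤ {k} {m} {a} {b} k≤m r = subst (λ j → Reach H j a b) (m∸n+n≡m k≤m) (lift (m ∸ k) r)
    where
    lift : ∀ d {k} → Reach H k a b → Reach H (d + k) a b
    lift zero    r = r
    lift (suc d) r = Reach-suc (lift d r)

  Reach-0 : ∀ {a b} → Reach H 0 a b → a ≡ b
  Reach-0 here = refl

  Reach-++ : ∀ {j l a b c} → Reach H j a b → Reach H l b c → Reach H (j + l) a c
  Reach-++ {j} {l} r here                   = Reach-≤ (m≤m+n j l) r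
  Reach-++ {j} {suc l} {a} {c = c} r (step r′ e) =
    subst (λ k → Reach H k a c) (sym (+-suc j l)) (step (Reach-++ r r′) e)

  Reach-reverse : IsSymmetric H → ∀ {k a b} → Reach H k a b → Reach H k b a
  Reach-reverse sym-H here                     = here
  Reach-reverse sym-H {a = a} {b} (step {w = w} r e) =
    Reach-++ {j = 1} (step here (trans (sym-H b w) e)) (Reach-reverse sym-H r)

  Reach⇒reach : ∀ {k a b} → Reach H k a b → reach H k a b ≡ true
  Reach⇒reach {zero}  here = ==-refl _
  Reach⇒reach {suc k} {a} here rewrite Reach⇒reach {k} {a} here = refl
  Reach⇒reach {suc k} {a} {b} (step {w = w} r e) with reach H k a b
  ... | true  = refl
  ... | false = any-intro (λ v → reach H k a v ∧ H v b) w (cong₂ _∧_ (Reach⇒reach r) e)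

  reach⇒Reach : ∀ k {a b} → reach H k a b ≡ true → Reach H k a b
  reach⇒Reach zero    e rewrite ==⇒≡ e = here
  reach⇒Reach (suc k) {a} {b} e with reach H k a b in a~b
  ... | true  = Reach-suc (reach⇒Reach k a~b)
  ... | false with any-witness (λ v → reach H k a v ∧ H v b) e
  ...   | w , e′ = step (reach⇒Reach k (∧-conicalˡ _ _ e′)) (∧-conicalʳ _ _ e′)

Reach-last : ∀ {n} {H : Graph n} {m a v} → Reach H m a v →
  a ≡ v ⊎ ∃[ w ] ∃[ m′ ] m ≡ suc m′ × Reach H m′ a w × H w v ≡ true
Reach-last here       = inj₁ refl
Reach-last (step r e) = inj₂ (_ , _ , refl , r , e)

-- The balls around a grow strictly until they stop growing for good, so
-- after n - 1 steps they contain every vertex reachable from a at all.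
module Ball {n} (H : Graph n) (a : Fin n) where

  ball : ℕ → Fin n → Bool
  ball k = reach H k a

  ball-⊆ : ∀ k v → ball k v ≡ true → ball (suc k) v ≡ true
  ball-⊆ k v e rewrite e = refl

  Stable : ℕ → Set
  Stable k = ∀ v → ball (suc k) v ≡ ball k v

  stable-+ : ∀ {k} → Stable k → ∀ m → Stable (m + k)
  stable-+ st zero    = st
  stable-+ st (suc m) v =
    cong₂ _∨_ (stable-+ st m v) (any-cong (λ w → cong (_∧ H w v) (stable-+ st m w)) (allFin n))

  ball-constant : ∀ {k} → Stable k → ∀ m v → ball (m + k) v ≡ ball k v
  ball-constant st zero    v = refl
  ball-constant st (suc m) v = trans (stable-+ st m v) (ball-constant st m v)

  stable-or-grows : ∀ k → Stable k ⊎ ∃[ v ] ball (suc k) v ≡ true × ball k v ≡ false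
  stable-or-grows k with all? (λ v → ball (suc k) v ≟ᵇ ball k v)
  ... | yes st  = inj₁ st
  ... | no ¬st with ¬∀⟶∃¬ n _ (λ v → ball (suc k) v ≟ᵇ ball k v) ¬st
  ...   | v , ne = inj₂ (v , grows (ball-⊆ k v) ne)
    where
    grows : ∀ {x y} → (x ≡ true → y ≡ true) → y ≢ x → y ≡ true × x ≡ false
    grows {false} {false} _ ne = contradiction refl ne
    grows {false} {true}  _ _  = refl , refl
    grows {true}          x⇒y ne = contradiction (x⇒y refl) ne

  ball-size : ∀ k → suc k ≤ card (ball k) ⊎ ∃[ j ] j ≤ k × Stable j
  ball-size zero = inj₁ (card-nonempty (ball 0) (==-refl a))
  ball-size (suc k) with ball-size k
  ... | inj₂ (j , j≤k , st) = inj₂ (j , m≤n⇒m≤1+n j≤k , st)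
  ... | inj₁ big with stable-or-grows k
  ...   | inj₁ st              = inj₂ (k , n≤1+n k , st)
  ...   | inj₂ (v , new , old) =
    inj₁ (≤-trans (s≤s big) (sum-mono-< (λ w → 𝟙-mono (ball-⊆ k w)) v new-counts))
    where
    new-counts : 𝟙 (ball k v) < 𝟙 (ball (suc k) v)
    new-counts rewrite new | old = ≤-refl

reach-saturates : ∀ {m} {H : Graph (suc m)} {k a b} → Reach H k a b → reach H m a b ≡ true
reach-saturates {m} {H} {k} {a} {b} r with Ball.ball-size H a m
... | inj₁ full             = card-full (Ball.ball H a m) full b
... | inj₂ (j , j≤m , st) = Reach⇒reach (Reach-≤ j≤m (reach⇒Reach j reach-j))
  where
  reach-j : reach H j a b ≡ true
  reach-j = trans (sym (Ball.ball-constant H a st (k ∸ j) b))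
                  (Reach⇒reach (Reach-≤ (subst (k ≤_) (+-comm j (k ∸ j)) (m≤n+m∸n k j)) r))

Reach⇒reach-n : ∀ {n} {H : Graph n} {k a b} → Reach H k a b → reach H n a b ≡ true
Reach⇒reach-n {zero}  {a = ()}
Reach⇒reach-n {suc m} r = Reach⇒reach (Reach-suc (reach⇒Reach m (reach-saturates r)))

firstTrue-≤ : ∀ B (f : ℕ → Bool) {k} → f k ≡ true → firstTrue B f ≤ k
firstTrue-≤ zero    f         fk = z≤n
firstTrue-≤ (suc B) f {k}     fk with f zero in f₀
... | true = z≤n
firstTrue-≤ (suc B) f {zero}  fk | false = contradiction (trans (sym fk) f₀) true≢false
firstTrue-≤ (suc B) f {suc k} fk | false = s≤s (firstTrue-≤ B (f ∘ suc) fk)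

firstTrue-true : ∀ B (f : ℕ → Bool) {k} → k < B → f k ≡ true → f (firstTrue B f) ≡ true
firstTrue-true (suc B) f {k}     k<B fk with f zero in f₀
... | true = f₀
firstTrue-true (suc B) f {zero}  k<B fk | false = contradiction (trans (sym fk) f₀) true≢false
firstTrue-true (suc B) f {suc k} k<B fk | false = firstTrue-true B (f ∘ suc) (≤-pred k<B) fk

firstTrue-cong : ∀ B {f g : ℕ → Bool} → (∀ k → f k ≡ g k) → firstTrue B f ≡ firstTrue B g
firstTrue-cong zero    f≗g = refl
firstTrue-cong (suc B) {f} {g} f≗g rewrite f≗g zero with g zero
... | true  = refl
... | false = cong suc (firstTrue-cong B (f≗g ∘ suc))

dist-≤ : ∀ {n} {H : Graph n} {k a b} → Reach H k a b → dist H a b ≤ k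
dist-≤ {n} r = firstTrue-≤ n _ (Reach⇒reach r)

dist-Reach : ∀ {n} {H : Graph n} {k a b} → Reach H k a b → Reach H (dist H a b) a b
dist-Reach {zero}  {a = ()}
dist-Reach {suc m} {H} {a = a} {b} r =
  reach⇒Reach _ (firstTrue-true (suc m) (λ k → reach H k a b) (n<1+n m) (reach-saturates r))

dist-cong : ∀ {n} {H H′ : Graph n} {a b a′ b′} →
  (∀ {k} → Reach H k a b → Reach H′ k a′ b′) → (∀ {k} → Reach H′ k a′ b′ → Reach H k a b) →
  dist H a b ≡ dist H′ a′ b′
dist-cong {n} {H} {H′} {a} {b} {a′} {b′} to from = firstTrue-cong n same
  where
  same : ∀ k → reach H k a b ≡ reach H′ k a′ b′
  same k with reach H k a b in e | reach H′ k a′ b′ in e′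
  ... | true  | true  = refl
  ... | false | false = refl
  ... | true  | false = trans (sym (Reach⇒reach (to (reach⇒Reach k e)))) e′
  ... | false | true  = trans (sym e) (Reach⇒reach (from (reach⇒Reach k e′)))

dist-sym : ∀ {n} {H : Graph n} → IsSymmetric H → ∀ a b → dist H a b ≡ dist H b a
dist-sym sym-H a b = dist-cong (Reach-reverse sym-H) (Reach-reverse sym-H)

dist-refl : ∀ {n} (H : Graph n) a → dist H a a ≡ 0
dist-refl H a = n≤0⇒n≡0 (dist-≤ {H = H} {k = 0} here)

dist≡0⇒≡ : ∀ {n} {H : Graph n} {k a b} → Reach H k a b → dist H a b ≡ 0 → a ≡ b
dist≡0⇒≡ {H = H} {a = a} {b} r d≡0 = Reach-0 (subst (λ k → Reach H k a b) d≡0 (dist-Reach r))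

dist-unique : ∀ {n} {H : Graph n} {m a b} → Reach H m a b → (∀ {k} → Reach H k a b → m ≤ k) → dist H a b ≡ m
dist-unique r minimal = ≤-antisym (dist-≤ r) (minimal (dist-Reach r))

-- The Wiener index

∑∑ : ∀ {n} → (Fin n → Fin n → ℕ) → ℕ
∑∑ f = sum (λ a → sum (λ b → f a b))

∑∑-cong : ∀ {n} {f g : Fin n → Fin n → ℕ} → (∀ a b → f a b ≡ g a b) → ∑∑ f ≡ ∑∑ g
∑∑-cong f≗g = sum-cong-≗ (λ a → sum-cong-≗ (f≗g a))

∑∑-distrib-+ : ∀ {n} (f g : Fin n → Fin n → ℕ) → ∑∑ (λ a b → f a b + g a b) ≡ ∑∑ f + ∑∑ g
∑∑-distrib-+ {n} f g = trans (sum-cong-≗ (λ a → ∑-distrib-+ (f a) (g a))) (∑-distrib-+ {n} _ _)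

∑∑-flip : ∀ {n} (f : Fin n → Fin n → ℕ) → ∑∑ (λ a b → f b a) ≡ ∑∑ f
∑∑-flip f = sym (∑-comm f)

sum-if : ∀ {n} b (f : Fin n → ℕ) → sum (λ i → if b then f i else 0) ≡ (if b then sum f else 0)
sum-if {n} true  f = refl
sum-if {n} false f = sum-replicate-zero n

sum-if-card : ∀ {n} (P : Fin n → Bool) x → sum (λ i → if P i then x else 0) ≡ card P * x
sum-if-card {zero}  P x = refl
sum-if-card {suc n} P x with P zero
... | true  = cong (x +_) (sum-if-card (P ∘ suc) x)
... | false = sum-if-card (P ∘ suc) x

<ᵇ-true : ∀ {m n} → m < n → (m <ᵇ n) ≡ true
<ᵇ-true m<n = Equivalence.to T-≡ (<⇒<ᵇ m<n)

<ᵇ-false : ∀ {m n} → ¬ m < n → (m <ᵇ n) ≡ false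
<ᵇ-false {m} {n} m≮n with m <ᵇ n in e
... | false = refl
... | true  = contradiction (<ᵇ⇒< m n (Equivalence.from T-≡ e)) m≮n

split-by-order : ∀ {n} (a b : Fin n) x → (a ≡ b → x ≡ 0) →
  x ≡ (if toℕ a <ᵇ toℕ b then x else 0) + (if toℕ b <ᵇ toℕ a then x else 0)
split-by-order a b x diag with <-cmp (toℕ a) (toℕ b)
... | tri< a<b _ b≮a rewrite <ᵇ-true a<b | <ᵇ-false b≮a = sym (+-identityʳ x)
... | tri> a≮b _ b<a rewrite <ᵇ-false a≮b | <ᵇ-true b<a = refl
... | tri≈ a≮b a≡b b≮a rewrite <ᵇ-false a≮b | <ᵇ-false b≮a = diag (toℕ-injective a≡b)

W-double : ∀ {n} (K : Graph n) → IsSymmetric K → W K + W K ≡ ∑∑ (dist K)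
W-double K sym-K = begin
  W K + W K                        ≡⟨ cong (λ w → w + w) W≡below ⟩
  ∑∑ below + ∑∑ below              ≡⟨ cong (∑∑ below +_) (∑∑-flip below) ⟨
  ∑∑ below + ∑∑ (λ a b → below b a) ≡⟨ ∑∑-distrib-+ below (λ a b → below b a) ⟨
  ∑∑ (λ a b → below a b + below b a) ≡⟨ ∑∑-cong split ⟨
  ∑∑ (dist K)                      ∎
  where
  open ≡-Reasoning
  below : _ → _ → ℕ
  below a b = if toℕ a <ᵇ toℕ b then dist K a b else 0
  W≡below : W K ≡ ∑∑ below
  W≡below = trans (Σv≡sum (λ a → Σv (below a))) (sum-cong-≗ (λ a → Σv≡sum (below a)))
  split : ∀ a b → dist K a b ≡ below a b + below b a
  split a b = trans (split-by-order a b (dist K a b) (λ { refl → dist-refl K a }))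
                    (cong ((if toℕ a <ᵇ toℕ b then dist K a b else 0) +_)
                          (cong (if toℕ b <ᵇ toℕ a then_else 0) (dist-sym sym-K a b)))

double-injective : ∀ {m n} → m + m ≡ n + n → m ≡ n
double-injective {m} {n} e = *-cancelˡ-≡ m n 2 (trans (cong (m +_) (+-identityʳ m)) (trans e (sym (cong (n +_) (+-identityʳ n)))))

-- Gates

Gate : ∀ {n} → Graph n → (Fin n → Bool) → Fin n → Set
Gate {n} K S u = ∀ {a b : Fin n} → S a ≡ true → K a b ≡ true → S b ≡ false → b ≡ u

in≢out : ∀ {n} (S : Fin n → Bool) {a b} → S a ≡ true → S b ≡ false → a ≢ b
in≢out S Sa Sb refl = true≢false (trans (sym Sa) Sb)

module _ {n} {K : Graph n} {S : Fin n → Bool} {u : Fin n} (gate : Gate K S u) where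

  Reach-through-gate : ∀ {k a b} → S a ≡ true → Reach K k a b → S b ≡ false →
    ∃[ j ] ∃[ l ] j + l ≤ k × Reach K j a u × Reach K l u b
  Reach-through-gate Sa here Sb = contradiction (trans (sym Sa) Sb) true≢false
  Reach-through-gate {suc k} Sa (step {w = w} r e) Sb with S w in Sw
  ... | true with gate Sw e Sb
  ...   | refl = suc k , 0 , ≤-reflexive (+-identityʳ (suc k)) , step r e , here
  Reach-through-gate {suc k} Sa (step r e) Sb | false with Reach-through-gate Sa r Sw
  ...   | j , l , j+l≤k , a→u , u→w =
    j , suc l , subst (_≤ suc k) (sym (+-suc j l)) (s≤s j+l≤k) , a→u , step u→w e

  dist-through-gate : ∀ {k a b} → S a ≡ true → Reach K k a b → S b ≡ false →
    dist K a b ≡ dist K a u + dist K u b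
  dist-through-gate {a = a} {b} Sa r Sb with Reach-through-gate Sa r Sb
  ... | _ , _ , _ , a→u , u→b = dist-unique (Reach-++ (dist-Reach a→u) (dist-Reach u→b)) minimal
    where
    minimal : ∀ {k} → Reach K k a b → dist K a u + dist K u b ≤ k
    minimal r′ with Reach-through-gate Sa r′ Sb
    ... | j , l , j+l≤k , a→u′ , u→b′ = ≤-trans (+-mono-≤ (dist-≤ a→u′) (dist-≤ u→b′)) j+l≤k

Reach-map : ∀ {n} {K K′ : Graph n} (ρ : Fin n → Fin n) →
  (∀ {v w} → K v w ≡ true → ρ v ≡ ρ w ⊎ K′ (ρ v) (ρ w) ≡ true) →
  ∀ {k a b} → Reach K k a b → Reach K′ k (ρ a) (ρ b)
Reach-map ρ hom here = here
Reach-map {K′ = K′} ρ hom (step r e) with hom e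
... | inj₁ same = Reach-suc (subst (Reach K′ _ _) same (Reach-map ρ hom r))
... | inj₂ e′   = step (Reach-map ρ hom r) e′

module _ {n} {K K′ : Graph n} {S : Fin n → Bool} {u : Fin n} (gate : Gate K S u) (sym-K : IsSymmetric K)
  (agree : ∀ {a b} → S a ≡ false → S b ≡ false → K a b ≡ true → K′ a b ≡ true) where

  collapse : Fin n → Fin n
  collapse v = if S v then u else v

  collapse-hom : ∀ {v w} → K v w ≡ true → collapse v ≡ collapse w ⊎ K′ (collapse v) (collapse w) ≡ true
  collapse-hom {v} {w} e with S v in Sv | S w in Sw
  ... | true  | true  = inj₁ refl
  ... | true  | false = inj₁ (sym (gate Sv e Sw))
  ... | false | true  = inj₁ (gate Sw (trans (sym-K w v) e) Sv)
  ... | false | false = inj₂ (agree Sv Sw e)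

  Reach-outside : ∀ {k a b} → S a ≡ false → S b ≡ false → Reach K k a b → Reach K′ k a b
  Reach-outside {k} Sa Sb r = subst₂ (Reach K′ k) (fixed Sa) (fixed Sb) (Reach-map collapse collapse-hom r)
    where
    fixed : ∀ {v} → S v ≡ false → collapse v ≡ v
    fixed Sv rewrite Sv = refl

module _ {n} {K K′ : Graph n} {S : Fin n → Bool} {u : Fin n} (gate : Gate K S u)
  (sym-K : IsSymmetric K) (sym-K′ : IsSymmetric K′) (u′ : Fin n)
  (agree : ∀ {a b} → S a ≡ true → S b ≡ true → K a b ≡ true → K′ a b ≡ true)
  (agree-gate : ∀ {a} → S a ≡ true → K a u ≡ true → K′ a u′ ≡ true) where

  retract : Fin n → Fin n
  retract v = if S v then v else u′

  retract-hom : ∀ {v w} → K v w ≡ true → retract v ≡ retract w ⊎ K′ (retract v) (retract w) ≡ true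
  retract-hom {v} {w} e with S v in Sv | S w in Sw
  ... | true  | true  = inj₂ (agree Sv Sw e)
  ... | false | false = inj₁ refl
  ... | true  | false with gate Sv e Sw
  ...   | refl = inj₂ (agree-gate Sv e)
  retract-hom {v} {w} e | false | true with gate Sw (trans (sym-K w v) e) Sv
  ...   | refl = inj₂ (trans (sym-K′ u′ w) (agree-gate Sw (trans (sym-K w v) e)))

  retract-in : ∀ {v} → S v ≡ true → retract v ≡ v
  retract-in Sv rewrite Sv = refl

  retract-out : ∀ {v} → S v ≡ false → retract v ≡ u′
  retract-out Sv rewrite Sv = refl

  Reach-inside : ∀ {k a b} → S a ≡ true → S b ≡ true → Reach K k a b → Reach K′ k a b
  Reach-inside {k} Sa Sb r = subst₂ (Reach K′ k) (retract-in Sa) (retract-in Sb) (Reach-map retract retract-hom r)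

  Reach-to-gate : ∀ {k a} → S a ≡ true → S u ≡ false → Reach K k a u → Reach K′ k a u′
  Reach-to-gate {k} Sa Su r = subst₂ (Reach K′ k) (retract-in Sa) (retract-out Su) (Reach-map retract retract-hom r)

-- Moving a pendant set to another gate

moveAt : ∀ {n} → Graph n → (Fin n → Bool) → (us ut : Fin n) → Graph n
moveAt H S us ut a b =
  if ((a == us) ∧ S b) ∨ ((b == us) ∧ S a) then false
  else if (a == ut) ∧ S b then H us b
  else if (b == ut) ∧ S a then H a us
  else H a b

module MoveAt {n} (H : Graph n) (S : Fin n → Bool) (us ut : Fin n)
  (S-us : S us ≡ false) (S-ut : S ut ≡ false) (us≢ut : us ≢ ut) (sym-H : IsSymmetric H)
  (gate : Gate H S us) (connected : ∀ a b → ∃[ k ] Reach H k a b) where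

  H′ : Graph n
  H′ = moveAt H S us ut

  moveAt-away : ∀ {a b} → a ≢ us → b ≢ us → a ≢ ut → b ≢ ut → H′ a b ≡ H a b
  moveAt-away a≢us b≢us a≢ut b≢ut
    rewrite ≢⇒==≡false a≢us | ≢⇒==≡false b≢us | ≢⇒==≡false a≢ut | ≢⇒==≡false b≢ut = refl

  moveAt-outside : ∀ {a b} → S a ≡ false → S b ≡ false → H′ a b ≡ H a b
  moveAt-outside {a} {b} Sa Sb
    rewrite Sa | Sb | ∧-zeroʳ (a == us) | ∧-zeroʳ (b == us) | ∧-zeroʳ (a == ut) | ∧-zeroʳ (b == ut) = refl

  moveAt-inside : ∀ {a b} → S a ≡ true → S b ≡ true → H′ a b ≡ H a b
  moveAt-inside Sa Sb = moveAt-away (in≢out S Sa S-us) (in≢out S Sb S-us) (in≢out S Sa S-ut) (in≢out S Sb S-ut)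

  moveAt-from-ut : ∀ {b} → S b ≡ true → H′ ut b ≡ H us b
  moveAt-from-ut Sb
    rewrite ≢⇒==≡false (us≢ut ∘ sym) | ≢⇒==≡false (in≢out S Sb S-us) | ==-refl ut | Sb = refl

  moveAt-from-us : ∀ {b} → S b ≡ true → H′ us b ≡ false
  moveAt-from-us Sb rewrite ==-refl us | Sb = refl

  moveAt-fixed : ∀ {a v} → S v ≡ false → v ≢ us → v ≢ ut → H′ a v ≡ H a v
  moveAt-fixed {a} Sv v≢us v≢ut
    rewrite Sv | ≢⇒==≡false v≢us | ≢⇒==≡false v≢ut | ∧-zeroʳ (a == us) | ∧-zeroʳ (a == ut) = refl

  moveAt-sym : IsSymmetric H′
  moveAt-sym a b rewrite ∨-comm ((a == us) ∧ S b) ((b == us) ∧ S a)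
    with ((b == us) ∧ S a) ∨ ((a == us) ∧ S b)
  ... | true = refl
  ... | false with (a == ut) ∧ S b in a-ut | (b == ut) ∧ S a in b-ut
  ...   | true  | true  = contradiction (trans (sym (∧-conicalʳ _ _ b-ut))
                            (trans (cong S (==⇒≡ (∧-conicalˡ _ _ a-ut))) S-ut)) true≢false
  ...   | true  | false = sym-H us b
  ...   | false | true  = sym-H a us
  ...   | false | false = sym-H a b

  moveAt-gate : Gate H′ S ut
  moveAt-gate {a} {b} Sa e Sb = decide (b ≟F ut) (b ≟F us)
    where
    decide : Dec (b ≡ ut) → Dec (b ≡ us) → b ≡ ut
    decide (yes b≡ut) _        = b≡ut
    decide (no _)     (yes b≡us) =
      contradiction (trans (sym e) (trans (cong (H′ a) b≡us) (trans (moveAt-sym a us) (moveAt-from-us Sa)))) true≢false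
    decide (no b≢ut)  (no b≢us)  =
      contradiction (gate Sa (trans (sym (moveAt-away (in≢out S Sa S-us) b≢us (in≢out S Sa S-ut) b≢ut)) e) Sb) b≢us

  private
    d d′ : Fin n → Fin n → ℕ
    d  = dist H
    d′ = dist H′

    outside⇒ : ∀ {a b} → S a ≡ false → S b ≡ false → H a b ≡ true → H′ a b ≡ true
    outside⇒ Sa Sb e = trans (moveAt-outside Sa Sb) e

    outside⇐ : ∀ {a b} → S a ≡ false → S b ≡ false → H′ a b ≡ true → H a b ≡ true
    outside⇐ Sa Sb e = trans (sym (moveAt-outside Sa Sb)) e

    inside⇒ : ∀ {a b} → S a ≡ true → S b ≡ true → H a b ≡ true → H′ a b ≡ true
    inside⇒ Sa Sb e = trans (moveAt-inside Sa Sb) e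

    inside⇐ : ∀ {a b} → S a ≡ true → S b ≡ true → H′ a b ≡ true → H a b ≡ true
    inside⇐ Sa Sb e = trans (sym (moveAt-inside Sa Sb)) e

    gate⇒ : ∀ {a} → S a ≡ true → H a us ≡ true → H′ a ut ≡ true
    gate⇒ {a} Sa e = trans (moveAt-sym a ut) (trans (moveAt-from-ut Sa) (trans (sym-H us a) e))

    gate⇐ : ∀ {a} → S a ≡ true → H′ a ut ≡ true → H a us ≡ true
    gate⇐ {a} Sa e = trans (sym-H a us) (trans (sym (moveAt-from-ut Sa)) (trans (moveAt-sym ut a) e))

  dist-outside : ∀ {a b} → S a ≡ false → S b ≡ false → d′ a b ≡ d a b
  dist-outside Sa Sb = dist-cong (Reach-outside moveAt-gate moveAt-sym outside⇐ Sa Sb)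
                                 (Reach-outside gate sym-H outside⇒ Sa Sb)

  dist-inside : ∀ {a b} → S a ≡ true → S b ≡ true → d′ a b ≡ d a b
  dist-inside Sa Sb = dist-cong (Reach-inside moveAt-gate moveAt-sym sym-H us inside⇐ gate⇐ Sa Sb)
                                (Reach-inside gate sym-H moveAt-sym ut inside⇒ gate⇒ Sa Sb)

  dist-to-gate : ∀ {a} → S a ≡ true → d′ a ut ≡ d a us
  dist-to-gate Sa = dist-cong (Reach-to-gate moveAt-gate moveAt-sym sym-H us inside⇐ gate⇐ Sa S-ut)
                              (Reach-to-gate gate sym-H moveAt-sym ut inside⇒ gate⇒ Sa S-us)

  dist-across : ∀ {a b} → S a ≡ true → S b ≡ false → d a b ≡ d a us + d us b
  dist-across {a} {b} Sa Sb = dist-through-gate gate Sa (proj₂ (connected a b)) Sb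

  dist′-across : ∀ {a b} → S a ≡ true → S b ≡ false → d′ a b ≡ d a us + d ut b
  dist′-across {a} {b} Sa Sb = begin
    d′ a b             ≡⟨ dist-through-gate moveAt-gate Sa walk Sb ⟩
    d′ a ut + d′ ut b  ≡⟨ cong₂ _+_ (dist-to-gate Sa) (dist-outside S-ut Sb) ⟩
    d a us + d ut b    ∎
    where
    open ≡-Reasoning
    walk : Reach H′ _ a b
    walk = Reach-++ (Reach-to-gate gate sym-H moveAt-sym ut inside⇒ gate⇒ Sa S-us (proj₂ (connected a us)))
                    (Reach-outside gate sym-H outside⇒ S-ut Sb (proj₂ (connected ut b)))

  across-identity : ∀ {a b} → S a ≡ true → S b ≡ false → d′ a b + d us b ≡ d a b + d ut b
  across-identity {a} {b} Sa Sb = begin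
    d′ a b + d us b             ≡⟨ cong (_+ d us b) (dist′-across Sa Sb) ⟩
    d a us + d ut b + d us b    ≡⟨ xy∙z≈xz∙y (d a us) (d ut b) (d us b) ⟩
    d a us + d us b + d ut b    ≡⟨ cong (_+ d ut b) (dist-across Sa Sb) ⟨
    d a b + d ut b              ∎
    where open ≡-Reasoning

  outsideDist : Fin n → ℕ
  outsideDist u = sum (λ b → if S b then 0 else d u b)

  cross : Fin n → Fin n → Fin n → ℕ
  cross u a b = if S a then (if S b then 0 else d u b) else 0

  pair-identity : ∀ a b → d′ a b + (cross us a b + cross us b a) ≡ d a b + (cross ut a b + cross ut b a)
  pair-identity a b with S a in Sa | S b in Sb
  ... | true  | true  = cong (_+ 0) (dist-inside Sa Sb)
  ... | false | false = cong (_+ 0) (dist-outside Sa Sb)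
  ... | true  | false rewrite +-identityʳ (d us b) | +-identityʳ (d ut b) = across-identity Sa Sb
  ... | false | true  = begin
    d′ a b + d us a   ≡⟨ cong (_+ d us a) (dist-sym moveAt-sym a b) ⟩
    d′ b a + d us a   ≡⟨ across-identity Sb Sa ⟩
    d b a + d ut a    ≡⟨ cong (_+ d ut a) (dist-sym sym-H b a) ⟩
    d a b + d ut a    ∎
    where open ≡-Reasoning

  ∑∑-dist-cross : ∀ (K : Graph n) → IsSymmetric K → ∀ u →
    ∑∑ (λ a b → dist K a b + (cross u a b + cross u b a)) ≡ (W K + card S * outsideDist u) + (W K + card S * outsideDist u)
  ∑∑-dist-cross K sym-K u = begin
    ∑∑ (λ a b → dist K a b + (cross u a b + cross u b a))
      ≡⟨ trans (∑∑-distrib-+ (dist K) _) (cong (∑∑ (dist K) +_) (∑∑-distrib-+ (cross u) _)) ⟩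
    ∑∑ (dist K) + (∑∑ (cross u) + ∑∑ (λ a b → cross u b a))
      ≡⟨ cong (λ y → ∑∑ (dist K) + (∑∑ (cross u) + y)) (∑∑-flip (cross u)) ⟩
    ∑∑ (dist K) + (∑∑ (cross u) + ∑∑ (cross u))
      ≡⟨ cong₂ (λ x y → x + (y + y)) (sym (W-double K sym-K)) cross-total ⟩
    (W K + W K) + (card S * outsideDist u + card S * outsideDist u)
      ≡⟨ interchange (W K) (W K) _ _ ⟩
    (W K + card S * outsideDist u) + (W K + card S * outsideDist u)
      ∎
    where
    open ≡-Reasoning
    cross-total : ∑∑ (cross u) ≡ card S * outsideDist u
    cross-total = trans (sum-cong-≗ (λ a → sum-if (S a) (λ b → if S b then 0 else d u b))) (sum-if-card S (outsideDist u))

  -- Summing pair-identity over all ordered pairs gives twice the identity.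
  W-moveAt : W H′ + card S * outsideDist us ≡ W H + card S * outsideDist ut
  W-moveAt = double-injective (begin
    _ ≡⟨ ∑∑-dist-cross H′ moveAt-sym us ⟨
    ∑∑ (λ a b → d′ a b + (cross us a b + cross us b a)) ≡⟨ ∑∑-cong pair-identity ⟩
    ∑∑ (λ a b → d a b + (cross ut a b + cross ut b a))  ≡⟨ ∑∑-dist-cross H sym-H ut ⟩
    _ ∎)
    where open ≡-Reasoning

-- Matchings

Disjoint : ∀ {n} → Fin n × Fin n → Fin n × Fin n → Set
Disjoint p q = (proj₁ p ≢ proj₁ q) × (proj₁ p ≢ proj₂ q) × (proj₂ p ≢ proj₁ q) × (proj₂ p ≢ proj₂ q)

Disjoint-sym : ∀ {n} {p q : Fin n × Fin n} → Disjoint p q → Disjoint q p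
Disjoint-sym (d₁ , d₂ , d₃ , d₄) = d₁ ∘ sym , d₃ ∘ sym , d₂ ∘ sym , d₄ ∘ sym

module MatchingTransfer {n} {H H′ : Graph n} (sym-H : IsSymmetric H) {s t x y : Fin n}
  (x-leaf : ∀ {b} → H x b ≡ true → b ≡ s) (y-leaf : ∀ {b} → H y b ≡ true → b ≡ t)
  (sx : H′ s x ≡ true) (ty : H′ t y ≡ true)
  (agree : ∀ {a b} → a ≢ s → b ≢ s → a ≢ t → b ≢ t → H a b ≡ true → H′ a b ≡ true)
  (s≢t : s ≢ t) (x≢y : x ≢ y) (x≢t : x ≢ t) (y≢s : y ≢ s) where

  data Kind (a b : Fin n) : Set where
    at-s : a ≡ s ⊎ b ≡ s → Kind a b
    at-t : a ≡ t ⊎ b ≡ t → Kind a b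
    away : a ≢ s → b ≢ s → a ≢ t → b ≢ t → Kind a b

  kind : ∀ a b → Kind a b
  kind a b with a ≟F s | b ≟F s | a ≟F t | b ≟F t
  ... | yes a≡s | _       | _       | _       = at-s (inj₁ a≡s)
  ... | no _    | yes b≡s | _       | _       = at-s (inj₂ b≡s)
  ... | no _    | no _    | yes a≡t | _       = at-t (inj₁ a≡t)
  ... | no _    | no _    | no _    | yes b≡t = at-t (inj₂ b≡t)
  ... | no a≢s  | no b≢s  | no a≢t  | no b≢t  = away a≢s b≢s a≢t b≢t

  image : ∀ {a b} → Kind a b → Fin n × Fin n
  image (at-s _)         = s , x
  image (at-t _)         = t , y
  image {a} {b} (away _ _ _ _) = a , b

  image-edge : ∀ {a b} → H a b ≡ true → (κ : Kind a b) → H′ (proj₁ (image κ)) (proj₂ (image κ)) ≡ true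
  image-edge e (at-s _)                  = sx
  image-edge e (at-t _)                  = ty
  image-edge e (away a≢s b≢s a≢t b≢t) = agree a≢s b≢s a≢t b≢t e

  shared : ∀ {u a b a′ b′ : Fin n} → a ≡ u ⊎ b ≡ u → a′ ≡ u ⊎ b′ ≡ u → ¬ Disjoint (a , b) (a′ , b′)
  shared (inj₁ refl) (inj₁ refl) (d₁ , _ , _ , _)  = d₁ refl
  shared (inj₁ refl) (inj₂ refl) (_ , d₂ , _ , _)  = d₂ refl
  shared (inj₂ refl) (inj₁ refl) (_ , _ , d₃ , _)  = d₃ refl
  shared (inj₂ refl) (inj₂ refl) (_ , _ , _ , d₄)  = d₄ refl

  away-s : ∀ {a b} → H a b ≡ true → a ≢ s → b ≢ s → a ≢ t → b ≢ t → Disjoint (s , x) (a , b)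
  away-s {a} {b} e a≢s b≢s _ _ =
    (a≢s ∘ sym) , (b≢s ∘ sym) , (λ { refl → b≢s (x-leaf e) }) , (λ { refl → a≢s (x-leaf (trans (sym-H x a) e)) })

  away-t : ∀ {a b} → H a b ≡ true → a ≢ s → b ≢ s → a ≢ t → b ≢ t → Disjoint (t , y) (a , b)
  away-t {a} {b} e _ _ a≢t b≢t =
    (a≢t ∘ sym) , (b≢t ∘ sym) , (λ { refl → b≢t (y-leaf e) }) , (λ { refl → a≢t (y-leaf (trans (sym-H y a) e)) })

  s-t : Disjoint (s , x) (t , y)
  s-t = s≢t , (y≢s ∘ sym) , x≢t , x≢y

  image-disjoint : ∀ {a b a′ b′} → H a b ≡ true → H a′ b′ ≡ true → Disjoint (a , b) (a′ , b′) →
    (κ : Kind a b) (κ′ : Kind a′ b′) → Disjoint (image κ) (image κ′)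
  image-disjoint e e′ d (at-s p)         (at-s p′)         = ⊥-elim (shared p p′ d)
  image-disjoint e e′ d (at-s _)         (at-t _)          = s-t
  image-disjoint e e′ d (at-s _)         (away p₁ p₂ p₃ p₄) = away-s e′ p₁ p₂ p₃ p₄
  image-disjoint e e′ d (at-t _)         (at-s _)          = Disjoint-sym s-t
  image-disjoint e e′ d (at-t p)         (at-t p′)         = ⊥-elim (shared p p′ d)
  image-disjoint e e′ d (at-t _)         (away p₁ p₂ p₃ p₄) = away-t e′ p₁ p₂ p₃ p₄
  image-disjoint e e′ d (away p₁ p₂ p₃ p₄) (at-s _)        = Disjoint-sym (away-s e p₁ p₂ p₃ p₄)
  image-disjoint e e′ d (away p₁ p₂ p₃ p₄) (at-t _)        = Disjoint-sym (away-t e p₁ p₂ p₃ p₄)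
  image-disjoint e e′ d (away _ _ _ _)   (away _ _ _ _)    = d

  transfer : ∀ {m} → HasMatching H m → HasMatching H′ m
  transfer (M , edges , disjoint) =
    (λ i → image (kind′ i)) , (λ i → image-edge (edges i) (kind′ i)) ,
    (λ i j i≢j → image-disjoint (edges i) (edges j) (disjoint i j i≢j) (kind′ i) (kind′ j))
    where
    kind′ : ∀ i → Kind (proj₁ (M i)) (proj₂ (M i))
    kind′ i = kind (proj₁ (M i)) (proj₂ (M i))

same-matching-number : ∀ {n} {H H′ : Graph n} →
  (∀ {m} → HasMatching H m → HasMatching H′ m) → (∀ {m} → HasMatching H′ m → HasMatching H m) →
  ∀ {k} → IsMatchingNumber H k → IsMatchingNumber H′ k
same-matching-number to from (has , maximal) = to has , λ m h → maximal m (from h)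

next : ∀ {g} → Fin g → Fin g
next {suc g} k with toℕ k <? g
... | yes k<g = fromℕ< (s≤s k<g)
... | no _    = zero

toℕ-next : ∀ {g} (k : Fin g) → toℕ (next k) ≡ suc (toℕ k) ⊎ (suc (toℕ k) ≡ g × toℕ (next k) ≡ 0)
toℕ-next {suc g} k with toℕ k <? g
... | yes k<g = inj₁ (toℕ-fromℕ< (s≤s k<g))
... | no k≮g  = inj₂ (cong suc (≤-antisym (≤-pred (toℕ<n k)) (≮⇒≥ k≮g)) , refl)

≡ᵇ-true : ∀ {m n} → m ≡ n → (m ≡ᵇ n) ≡ true
≡ᵇ-true {m} {n} m≡n = Equivalence.to T-≡ (≡⇒≡ᵇ m n m≡n)

consec-next : ∀ {g} (k : Fin g) → consec k (next k) ≡ true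
consec-next {g} k with toℕ-next k
... | inj₁ e         rewrite e | ≡ᵇ-true {suc (toℕ k)} refl = refl
... | inj₂ (e₁ , e₂) rewrite e₂ = trans (∧-identityʳ _) (≡ᵇ-true (cong (_∸ 1) e₁))

next-next : ∀ {g} → 3 ≤ g → (k : Fin g) → next (next k) ≢ k
next-next {g} 3≤g k eq = impossible (toℕ-next k) (toℕ-next (next k))
  where
  twice : toℕ (next (next k)) ≡ toℕ k
  twice = cong toℕ eq
  too-small : g ≤ 2 → ⊥
  too-small g≤2 = contradiction (≤-trans 3≤g g≤2) (λ { (s≤s (s≤s ())) })
  impossible : toℕ (next k) ≡ suc (toℕ k) ⊎ (suc (toℕ k) ≡ g × toℕ (next k) ≡ 0) →
    toℕ (next (next k)) ≡ suc (toℕ (next k)) ⊎ (suc (toℕ (next k)) ≡ g × toℕ (next (next k)) ≡ 0) → ⊥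
  impossible (inj₁ e₁) (inj₁ e₂) =
    <⇒≢ (≤-trans (n<1+n (toℕ k)) (n≤1+n _)) (trans (sym twice) (trans e₂ (cong suc e₁)))
  impossible (inj₁ e₁) (inj₂ (g≡ , e₂)) =
    too-small (≤-reflexive (trans (sym g≡) (cong suc (trans e₁ (cong suc (trans (sym twice) e₂))))))
  impossible (inj₂ (g≡ , e₁)) (inj₁ e₂) =
    too-small (≤-reflexive (trans (sym g≡) (cong suc (trans (sym twice) (trans e₂ (cong suc e₁))))))
  impossible (inj₂ (_ , e₁)) (inj₂ (g≡ , _)) =
    too-small (≤-trans (≤-reflexive (trans (sym g≡) (cong suc e₁))) (s≤s z≤n))

Edge : ∀ {n} → Graph n → Fin n → Fin n → Bool
Edge G a b = (toℕ a <ᵇ toℕ b) ∧ G a b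

edgeCount≡∑∑ : ∀ {n} (G : Graph n) → edgeCount G ≡ ∑∑ (λ a b → 𝟙 (Edge G a b))
edgeCount≡∑∑ G =
  trans (Σv≡sum (λ a → Σv (λ b → 𝟙 (Edge G a b)))) (sum-cong-≗ (λ a → Σv≡sum (λ b → 𝟙 (Edge G a b))))

edgeOf : ∀ {n} → Fin n → Fin n → Fin n × Fin n
edgeOf a b = if toℕ a <ᵇ toℕ b then (a , b) else (b , a)

edgeOf-injective : ∀ {n} {a b a′ b′ : Fin n} → edgeOf a b ≡ edgeOf a′ b′ →
  (a ≡ a′ × b ≡ b′) ⊎ (a ≡ b′ × b ≡ a′)
edgeOf-injective {a = a} {b} {a′} {b′} e with toℕ a <ᵇ toℕ b | toℕ a′ <ᵇ toℕ b′
... | true  | true  = inj₁ (,-injective e)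
... | true  | false = inj₂ (,-injective e)
... | false | true  = inj₂ (swap (,-injective e))
... | false | false = inj₁ (swap (,-injective e))

edgeOf-Edge : ∀ {n} {G : Graph n} → IsSymmetric G → ∀ {a b} → a ≢ b → G a b ≡ true →
  uncurry (Edge G) (edgeOf a b) ≡ true
edgeOf-Edge {G = G} sym-G {a} {b} a≢b e with toℕ a <ᵇ toℕ b in a<ᵇb
... | true  = cong₂ _∧_ a<ᵇb e
... | false = cong₂ _∧_ (<ᵇ-true b<a) (trans (sym-G b a) e)
  where
  b<a : toℕ b < toℕ a
  b<a = ≤∧≢⇒< (≮⇒≥ (λ a<b → true≢false (trans (sym (<ᵇ-true a<b)) a<ᵇb)))
               (λ b≡a → a≢b (toℕ-injective (sym b≡a)))

pair-==-false : ∀ {n} {p q : Fin n × Fin n} → p ≢ q → ((proj₁ p == proj₁ q) ∧ (proj₂ p == proj₂ q)) ≡ false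
pair-==-false {p = a , b} {a′ , b′} p≢q with a ≟F a′ | b ≟F b′
... | yes refl | yes refl = contradiction refl p≢q
... | yes _    | no _     = refl
... | no _     | _        = refl

∑∑-remove : ∀ {n} (E : Fin n → Fin n → Bool) {a b} → E a b ≡ true →
  ∑∑ (λ v w → 𝟙 (E v w)) ≡ suc (∑∑ (λ v w → 𝟙 (E v w ∧ not ((v == a) ∧ (w == b)))))
∑∑-remove {n} E {a} {b} Eab = begin
  ∑∑ (λ v w → 𝟙 (E v w))                 ≡⟨ ∑∑-cong split ⟩
  ∑∑ (λ v w → 𝟙 (rest v w) + 𝟙 (at v w))  ≡⟨ ∑∑-distrib-+ (λ v w → 𝟙 (rest v w)) (λ v w → 𝟙 (at v w)) ⟩
  ∑∑ (λ v w → 𝟙 (rest v w)) + ∑∑ (λ v w → 𝟙 (at v w)) ≡⟨ cong (∑∑ (λ v w → 𝟙 (rest v w)) +_) at-once ⟩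
  ∑∑ (λ v w → 𝟙 (rest v w)) + 1           ≡⟨ +-comm _ 1 ⟩
  suc (∑∑ (λ v w → 𝟙 (rest v w)))         ∎
  where
  open ≡-Reasoning
  at rest : Fin n → Fin n → Bool
  at v w = (v == a) ∧ (w == b)
  rest v w = E v w ∧ not (at v w)
  split : ∀ v w → 𝟙 (E v w) ≡ 𝟙 (rest v w) + 𝟙 (at v w)
  split v w with v ≟F a | w ≟F b | E v w in Evw
  ... | yes refl | yes refl | true  = refl
  ... | yes refl | yes refl | false = contradiction (trans (sym Eab) Evw) true≢false
  ... | yes _    | no _     | true  = refl
  ... | yes _    | no _     | false = refl
  ... | no _     | _        | true  = refl
  ... | no _     | _        | false = refl
  row : ∀ v → sum (λ w → 𝟙 (at v w)) ≡ (if v == a then 1 else 0)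
  row v with v == a
  ... | true  = card-singleton b
  ... | false = sum-replicate-zero n
  at-once : ∑∑ (λ v w → 𝟙 (at v w)) ≡ 1
  at-once = trans (sum-cong-≗ row) (trans (sum-if-card (_== a) 1) (cong (_* 1) (card-singleton a)))

injective-family-≤ : ∀ {n m} (E : Fin n → Fin n → Bool) (f : Fin m → Fin n × Fin n) →
  (∀ i → uncurry E (f i) ≡ true) → (∀ {i j} → f i ≡ f j → i ≡ j) → m ≤ ∑∑ (λ a b → 𝟙 (E a b))
injective-family-≤ {m = zero}  E f inE inj = z≤n
injective-family-≤ {m = suc m} E f inE inj =
  subst (suc m ≤_) (sym (∑∑-remove E (inE zero))) (s≤s (injective-family-≤ _ (f ∘ suc) inE′ (Fin-suc-injective ∘ inj)))
  where
  inE′ : ∀ i → (uncurry E (f (suc i)) ∧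
                not ((proj₁ (f (suc i)) == proj₁ (f zero)) ∧ (proj₂ (f (suc i)) == proj₂ (f zero)))) ≡ true
  inE′ i rewrite inE (suc i) | pair-==-false {p = f (suc i)} {f zero} (λ e → contradiction (inj e) λ ()) = refl

-- Unicyclic graphs

-- T_s without u_s and z; Defs.transplant A c s t z unfolds to moveAt A (pendant A c s z) (c s) (c t).
pendant : ∀ {n g} → Graph n → (Fin g → Fin n) → Fin g → Fin n → Fin n → Bool
pendant A c s z w = inBranch A c s w ∧ not (w == c s) ∧ not (w == z)

module UnicyclicGraph {n g} (G : Graph n) (c : Fin g → Fin n) (U : Unicyclic G c) where

  sym-G : IsSymmetric G
  sym-G = proj₁ (proj₁ U)

  connected : ∀ a b → ∃[ k ] Reach G k a b
  connected a b = proj₁ (proj₁ (proj₂ U) a b) , reach⇒Reach _ (proj₂ (proj₁ (proj₂ U) a b))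

  G-irreflexive : ∀ {a b} → G a b ≡ true → a ≢ b
  G-irreflexive {a} e refl = true≢false (trans (sym e) (proj₂ (proj₁ U) a))

  c-injective : ∀ i j → c i ≡ c j → i ≡ j
  c-injective = proj₁ (proj₂ (proj₂ (proj₂ (proj₂ U))))

  cycle-edge : ∀ k → G (c k) (c (next k)) ≡ true
  cycle-edge k = proj₂ (proj₂ (proj₂ (proj₂ (proj₂ U)))) k (next k) (consec-next k)

  F : Graph n
  F = forest G c

  F⊆G : ∀ {a b} → F a b ≡ true → G a b ≡ true
  F⊆G = ∧-conicalˡ _ _

  F-sym : IsSymmetric F
  F-sym a b = cong₂ _∧_ (sym-G a b) (cong not cycleEdge-sym)
    where
    cycleEdge-sym : cycleEdge c a b ≡ cycleEdge c b a
    cycleEdge-sym =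
      any-cong (λ i → any-cong (λ j → cong (consec i j ∧_) (∨-comm ((c i == a) ∧ (c j == b)) _)) (allFin g)) (allFin g)

  cycle-edge-∉F : ∀ k → F (c k) (c (next k)) ≡ false
  cycle-edge-∉F k = cong₂ _∧_ (cycle-edge k) (cong not is-cycleEdge)
    where
    is-cycleEdge : cycleEdge c (c k) (c (next k)) ≡ true
    is-cycleEdge = any-intro _ k (any-intro _ (next k)
      (cong₂ _∧_ (consec-next k) (cong₂ _∨_ (cong₂ _∧_ (==-refl (c k)) (==-refl (c (next k)))) refl)))

  off-forest⇒cycleEdge : ∀ {a b} → G a b ≡ true → F a b ≡ false → cycleEdge c a b ≡ true
  off-forest⇒cycleEdge {a} {b} Gab Fab =
    trans (sym (not-involutive _)) (cong not (subst (λ x → x ∧ not (cycleEdge c a b) ≡ false) Gab Fab))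

  off-forest-start : ∀ {a b} → G a b ≡ true → F a b ≡ false → ∃[ i ] c i ≡ a
  off-forest-start {a} {b} Gab Fab with any-witness _ (off-forest⇒cycleEdge Gab Fab)
  ... | i , e with any-witness _ e
  ...   | j , e′ with (c i == a) ∧ (c j == b) in ij | (c i == b) ∧ (c j == a) in ji
  ...     | true  | _     = i , ==⇒≡ (∧-conicalˡ _ _ ij)
  ...     | false | true  = j , ==⇒≡ (∧-conicalʳ _ _ ji)
  ...     | false | false = contradiction (∧-conicalʳ (consec i j) _ e′) λ ()

  off-forest-end : ∀ {a b} → G a b ≡ true → F a b ≡ false → ∃[ j ] c j ≡ b
  off-forest-end {a} {b} Gab Fab = off-forest-start (trans (sym-G b a) Gab) (trans (F-sym b a) Fab)

  -- If c i and c j (i ≢ j) were joined inside the forest, then every vertex would hang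
  -- below a cycle vertex other than c j.  Giving each vertex the cycle edge leaving it (for
  -- those cycle vertices) or the edge to its parent (otherwise), plus the cycle edge leaving
  -- c j, yields n + 1 distinct edges.
  module NoForestPath {i j : Fin g} (i≢j : i ≢ j) {k₀} (i→j : Reach F k₀ (c i) (c j)) where

    hang : ∀ {m a v} → Reach G m a v → ∃[ k ] ∃[ l ] Reach F l (c k) a → ∃[ k ] ∃[ l ] Reach F l (c k) v
    hang here below = below
    hang {v = v} (step {w = w} r e) below with F w v in Fwv
    ... | true  = let (k , l , r′) = hang r below in k , suc l , step r′ Fwv
    ... | false = let (k , ck≡v) = off-forest-end e Fwv in k , 0 , subst (Reach F 0 (c k)) ck≡v here

    rooted : ∀ v → ∃[ k ] k ≢ j × ∃[ l ] Reach F l (c k) v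
    rooted v with hang (proj₂ (connected (c i) v)) (i , 0 , here)
    ... | k , l , r with k ≟F j
    ...   | yes refl = i , i≢j , k₀ + l , Reach-++ i→j r
    ...   | no k≢j   = k , k≢j , l , r

    near : ℕ → Fin n → Bool
    near m v = any (λ k → not (k == j) ∧ reach F m (c k) v) (allFin g)

    near-intro : ∀ {k m v} → k ≢ j → Reach F m (c k) v → near m v ≡ true
    near-intro {k} k≢j r = any-intro _ k (cong₂ _∧_ (cong not (≢⇒==≡false k≢j)) (Reach⇒reach r))

    near-elim : ∀ {m v} → near m v ≡ true → ∃[ k ] k ≢ j × Reach F m (c k) v
    near-elim {m} e with any-witness _ e
    ... | k , e′ = k , ==≡false⇒≢ (not≡true (∧-conicalˡ _ _ e′)) , reach⇒Reach m (∧-conicalʳ (not (k == j)) _ e′)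

    bound : Fin n → ℕ
    bound v = proj₁ (proj₂ (proj₂ (rooted v)))

    depth : Fin n → ℕ
    depth v = firstTrue (suc (bound v)) (λ m → near m v)

    depth-near : ∀ v → near (depth v) v ≡ true
    depth-near v = firstTrue-true (suc (bound v)) (λ m → near m v) {bound v} ≤-refl
                     (near-intro (proj₁ (proj₂ (rooted v))) (proj₂ (proj₂ (proj₂ (rooted v)))))

    depth-≤ : ∀ {m v} → near m v ≡ true → depth v ≤ m
    depth-≤ {v = v} = firstTrue-≤ (suc (bound v)) (λ m → near m v)

    data Position (v : Fin n) : Set where
      root  : ∀ k → k ≢ j → c k ≡ v → Position v
      child : ∀ w → F w v ≡ true → depth w < depth v → Position v

    position : ∀ v → Position v
    position v with near-elim (depth-near v)
    ... | k , k≢j , r with Reach-last r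
    ...   | inj₁ ck≡v                   = root k k≢j ck≡v
    ...   | inj₂ (w , m , d≡ , r′ , Fwv) =
      child w Fwv (subst (depth w <_) (sym d≡) (s≤s (depth-≤ (near-intro k≢j r′))))

    cycleEdgeAt : Fin g → Fin n × Fin n
    cycleEdgeAt k = edgeOf (c k) (c (next k))

    edgeBelow : ∀ {v} → Position v → Fin n × Fin n
    edgeBelow (root k _ _)      = cycleEdgeAt k
    edgeBelow {v} (child w _ _) = edgeOf w v

    family : Fin (suc n) → Fin n × Fin n
    family zero    = cycleEdgeAt j
    family (suc v) = edgeBelow (position v)

    cycleEdgeAt-Edge : ∀ k → uncurry (Edge G) (cycleEdgeAt k) ≡ true
    cycleEdgeAt-Edge k = edgeOf-Edge sym-G (G-irreflexive (cycle-edge k)) (cycle-edge k)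

    family-Edge : ∀ a → uncurry (Edge G) (family a) ≡ true
    family-Edge zero = cycleEdgeAt-Edge j
    family-Edge (suc v) with position v
    ... | root k _ _    = cycleEdgeAt-Edge k
    ... | child w Fwv _ = edgeOf-Edge sym-G (G-irreflexive (F⊆G Fwv)) (F⊆G Fwv)

    cycleEdgeAt-injective : ∀ {k k′} → cycleEdgeAt k ≡ cycleEdgeAt k′ → k ≡ k′
    cycleEdgeAt-injective {k} {k′} e with edgeOf-injective e
    ... | inj₁ (same , _)      = c-injective k k′ same
    ... | inj₂ (cross₁ , cross₂) =
      contradiction (trans (cong next (sym (c-injective _ _ cross₁))) (c-injective _ _ cross₂)) (next-next 3≤g k′)
      where
      3≤g : 3 ≤ g
      3≤g = proj₁ (proj₂ (proj₂ (proj₂ U)))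

    cycle≢forest : ∀ {k w v} → cycleEdgeAt k ≡ edgeOf w v → F w v ≡ true → ⊥
    cycle≢forest {k} e Fwv with edgeOf-injective e
    ... | inj₁ (refl , refl) = true≢false (trans (sym Fwv) (cycle-edge-∉F k))
    ... | inj₂ (refl , refl) = true≢false (trans (sym Fwv) (trans (F-sym _ _) (cycle-edge-∉F k)))

    family-injective : ∀ {a b} → family a ≡ family b → a ≡ b
    family-injective {zero}  {zero}  e = refl
    family-injective {zero}  {suc v} e with position v
    ... | root k k≢j _  = contradiction (sym (cycleEdgeAt-injective e)) k≢j
    ... | child _ Fwv _ = ⊥-elim (cycle≢forest e Fwv)
    family-injective {suc v} {zero}  e with position v
    ... | root k k≢j _  = contradiction (cycleEdgeAt-injective e) k≢j
    ... | child _ Fwv _ = ⊥-elim (cycle≢forest (sym e) Fwv)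
    family-injective {suc v} {suc v′} e with position v | position v′
    ... | root k _ ck≡v | root k′ _ ck′≡v′ = cong suc (trans (sym ck≡v) (trans (cong c (cycleEdgeAt-injective e)) ck′≡v′))
    ... | root _ _ _    | child _ Fwv _    = ⊥-elim (cycle≢forest e Fwv)
    ... | child _ Fwv _ | root _ _ _       = ⊥-elim (cycle≢forest (sym e) Fwv)
    ... | child w _ w<v | child w′ _ w′<v′ with edgeOf-injective e
    ...   | inj₁ (_ , v≡v′)    = cong suc v≡v′
    ...   | inj₂ (refl , refl) = ⊥-elim (<-asym w<v w′<v′)

    absurd : ⊥
    absurd = <-irrefl refl (subst (suc n ≤_) edges≡n (injective-family-≤ (Edge G) family family-Edge family-injective))
      where
      edges≡n : ∑∑ (λ a b → 𝟙 (Edge G a b)) ≡ n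
      edges≡n = trans (sym (edgeCount≡∑∑ G)) (proj₁ (proj₂ (proj₂ U)))

  no-forest-path : ∀ {i j k} → i ≢ j → ¬ Reach F k (c i) (c j)
  no-forest-path i≢j r = NoForestPath.absurd i≢j r

  Branch : Fin g → Fin n → Bool
  Branch = inBranch G c

  Reach⇒Branch : ∀ {i k v} → Reach F k (c i) v → Branch i v ≡ true
  Reach⇒Branch = Reach⇒reach-n

  Branch⇒Reach : ∀ {i v} → Branch i v ≡ true → Reach F n (c i) v
  Branch⇒Reach = reach⇒Reach n

  Branch-closed : ∀ {i a b} → Branch i a ≡ true → F a b ≡ true → Branch i b ≡ true
  Branch-closed a∈Tᵢ Fab = Reach⇒Branch (step (Branch⇒Reach a∈Tᵢ) Fab)

  Branch-cycle : ∀ {i j} → Branch i (c j) ≡ true → i ≡ j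
  Branch-cycle {i} {j} cj∈Tᵢ with i ≟F j
  ... | yes i≡j = i≡j
  ... | no i≢j  = ⊥-elim (no-forest-path i≢j (Branch⇒Reach cj∈Tᵢ))

  Branch-disjoint : ∀ {i j a} → Branch i a ≡ true → Branch j a ≡ true → i ≡ j
  Branch-disjoint a∈Tᵢ a∈Tⱼ =
    Branch-cycle (Reach⇒Branch (Reach-++ (Branch⇒Reach a∈Tᵢ) (Reach-reverse F-sym (Branch⇒Reach a∈Tⱼ))))

  module Leaf {i z} (leaf : LeafAt G c i z) where

    leaf-off-cycle : ∀ j → z ≢ c j
    leaf-off-cycle j z≡cj with Branch-cycle (subst (λ v → Branch i v ≡ true) z≡cj (proj₁ leaf))
    ... | refl = G-irreflexive (proj₂ (proj₂ leaf)) (sym z≡cj)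

    leaf-forest : ∀ {b} → G z b ≡ true → F z b ≡ true
    leaf-forest {b} Gzb with F z b in Fzb
    ... | true  = refl
    ... | false = ⊥-elim (leaf-off-cycle _ (sym (proj₂ (off-forest-start Gzb Fzb))))

    leaf-neighbour : ∀ {b} → G z b ≡ true → b ≡ c i
    leaf-neighbour {b} Gzb with b ≟F c i
    ... | yes b≡ci = b≡ci
    ... | no b≢ci  = contradiction (subst (2 ≤_) degree≡1 two-neighbours) λ { (s≤s ()) }
      where
      degree≡1 : card (F z) ≡ 1
      degree≡1 = trans (sym (count≡card (F z))) (proj₁ (proj₂ leaf))
      two-neighbours : 2 ≤ card (F z)
      two-neighbours = card-pair (F z) (leaf-forest Gzb) (leaf-forest (trans (sym-G z (c i)) (proj₂ (proj₂ leaf)))) b≢ci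

  module Pendant {s z} (leaf : LeafAt G c s z) where
    open Leaf leaf

    P : Fin n → Bool
    P = pendant G c s z

    P-intro : ∀ {w} → Branch s w ≡ true → w ≢ c s → w ≢ z → P w ≡ true
    P-intro w∈Tₛ w≢cs w≢z rewrite w∈Tₛ | ≢⇒==≡false w≢cs | ≢⇒==≡false w≢z = refl

    P-elim : ∀ {w} → P w ≡ true → Branch s w ≡ true × w ≢ c s × w ≢ z
    P-elim {w} Pw = ∧-conicalˡ _ _ Pw
                  , ==≡false⇒≢ (not≡true (∧-conicalˡ _ _ rest))
                  , ==≡false⇒≢ (not≡true (∧-conicalʳ (not (w == c s)) _ rest))
      where
      rest : (not (w == c s) ∧ not (w == z)) ≡ true
      rest = ∧-conicalʳ (Branch s w) _ Pw

    P-root : P (c s) ≡ false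
    P-root rewrite ==-refl (c s) = ∧-zeroʳ _

    P-leaf : P z ≡ false
    P-leaf rewrite ==-refl z | ∧-zeroʳ (not (z == c s)) = ∧-zeroʳ _

    P-cycle : ∀ {t} → t ≢ s → P (c t) ≡ false
    P-cycle {t} t≢s with Branch s (c t) in ct∈Tₛ
    ... | true  = contradiction (sym (Branch-cycle ct∈Tₛ)) t≢s
    ... | false = refl

    P-gate-forest : ∀ {a b} → P a ≡ true → F a b ≡ true → P b ≡ false → b ≡ c s
    P-gate-forest {a} {b} Pa Fab Pb = decide (b ≟F c s) (b ≟F z)
      where
      decide : Dec (b ≡ c s) → Dec (b ≡ z) → b ≡ c s
      decide (yes b≡cs) _          = b≡cs
      decide (no _)     (yes b≡z)  =
        ⊥-elim (proj₁ (proj₂ (P-elim Pa)) (leaf-neighbour (trans (sym-G z a) (subst (λ v → G a v ≡ true) b≡z (F⊆G Fab)))))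
      decide (no b≢cs)  (no b≢z)   =
        contradiction (trans (sym (P-intro (Branch-closed (proj₁ (P-elim Pa)) Fab) b≢cs b≢z)) Pb) true≢false

    P-off-cycle : ∀ i → P (c i) ≡ false
    P-off-cycle i with i ≟F s
    ... | yes refl = P-root
    ... | no i≢s   = P-cycle i≢s

    P-gate : Gate G P (c s)
    P-gate {a} {b} Pa Gab Pb with F a b in Fab
    ... | true  = P-gate-forest Pa Fab Pb
    ... | false with off-forest-start Gab Fab
    ...   | i , refl = contradiction (trans (sym Pa) (P-off-cycle i)) true≢false

    P-nonempty : 3 ≤ branchSize G c s → 1 ≤ card P
    P-nonempty big = +-cancelʳ-≤ 2 1 (card P) (begin
      3                                            ≤⟨ subst (3 ≤_) (count≡card (Branch s)) big ⟩
      card (Branch s)                              ≤⟨ sum-mono-≤ cover ⟩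
      sum (λ v → 𝟙 (P v) + (𝟙 (v == c s) + 𝟙 (v == z))) ≡⟨ ∑-distrib-+ {n} _ _ ⟩
      card P + sum (λ v → 𝟙 (v == c s) + 𝟙 (v == z)) ≡⟨ cong (card P +_) (∑-distrib-+ {n} _ _) ⟩
      card P + (card (_== c s) + card (_== z))     ≡⟨ cong (card P +_) (cong₂ _+_ (card-singleton (c s)) (card-singleton z)) ⟩
      card P + 2                                   ∎)
      where
      open ≤-Reasoning
      cover : ∀ v → 𝟙 (Branch s v) ≤ 𝟙 (P v) + (𝟙 (v == c s) + 𝟙 (v == z))
      cover v with Branch s v | v == c s | v == z
      ... | false | _     | _     = z≤n
      ... | true  | true  | _     = s≤s z≤n
      ... | true  | false | true  = s≤s z≤n
      ... | true  | false | false = ≤-refl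

  module Transplant {s t z z′} (s≢t : s ≢ t) (leaf : LeafAt G c s z) (leaf′ : LeafAt G c t z′) where
    open Pendant leaf public
    private
      module L  = Leaf leaf
      module L′ = Leaf leaf′
      module Other = Pendant leaf′

    Q : Fin n → Bool
    Q = Other.P

    cs≢ct : c s ≢ c t
    cs≢ct = s≢t ∘ c-injective s t

    open MoveAt G P (c s) (c t) P-root (P-cycle (s≢t ∘ sym)) cs≢ct sym-G P-gate connected public

    P-other : ∀ {w} → Branch t w ≡ true → P w ≡ false
    P-other {w} w∈Tₜ with P w in Pw
    ... | false = refl
    ... | true  = contradiction (Branch-disjoint (proj₁ (P-elim Pw)) w∈Tₜ) s≢t

    z≢z′ : z ≢ z′
    z≢z′ refl = s≢t (Branch-disjoint (proj₁ leaf) (proj₁ leaf′))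

    G′-fixed : ∀ {v b} → P v ≡ false → v ≢ c s → v ≢ c t → H′ v b ≡ G v b
    G′-fixed {v} {b} Pv v≢cs v≢ct = trans (moveAt-sym v b) (trans (moveAt-fixed Pv v≢cs v≢ct) (sym-G b v))

    G⇒G′ : ∀ {m} → HasMatching G m → HasMatching H′ m
    G⇒G′ = MatchingTransfer.transfer sym-G L.leaf-neighbour L′.leaf-neighbour
      (trans (moveAt-fixed P-leaf (L.leaf-off-cycle s) (L.leaf-off-cycle t)) (proj₂ (proj₂ leaf)))
      (trans (moveAt-fixed (P-other (proj₁ leaf′)) (L′.leaf-off-cycle s) (L′.leaf-off-cycle t)) (proj₂ (proj₂ leaf′)))
      (λ a≢s b≢s a≢t b≢t e → trans (moveAt-away a≢s b≢s a≢t b≢t) e)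
      cs≢ct z≢z′ (L.leaf-off-cycle t) (L′.leaf-off-cycle s)

    G′⇒G : ∀ {m} → HasMatching H′ m → HasMatching G m
    G′⇒G = MatchingTransfer.transfer moveAt-sym
      (λ e → L.leaf-neighbour (trans (sym (G′-fixed P-leaf (L.leaf-off-cycle s) (L.leaf-off-cycle t))) e))
      (λ e → L′.leaf-neighbour
               (trans (sym (G′-fixed (P-other (proj₁ leaf′)) (L′.leaf-off-cycle s) (L′.leaf-off-cycle t))) e))
      (proj₂ (proj₂ leaf)) (proj₂ (proj₂ leaf′))
      (λ a≢s b≢s a≢t b≢t e → trans (sym (moveAt-away a≢s b≢s a≢t b≢t)) e)
      cs≢ct z≢z′ (L.leaf-off-cycle t) (L′.leaf-off-cycle s)

    matching : ∀ {k} → IsMatchingNumber G k → IsMatchingNumber H′ k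
    matching = same-matching-number {H = G} {H′ = H′} G⇒G′ G′⇒G

    rest : Fin n → ℕ
    rest u = sum (λ b → if P b ∨ Q b then 0 else dist G u b)

    δ : ℕ
    δ = dist G (c s) (c t)

    σ : ℕ
    σ = sum (λ b → if Q b then dist G (c t) b else 0)

    outside-split : ∀ u → outsideDist u ≡ rest u + sum (λ b → if Q b then dist G u b else 0)
    outside-split u = trans (sum-cong-≗ split) (∑-distrib-+ {n} _ _)
      where
      split : ∀ b → (if P b then 0 else dist G u b) ≡ (if P b ∨ Q b then 0 else dist G u b) + (if Q b then dist G u b else 0)
      split b with P b in Pb | Q b in Qb
      ... | true  | true  = contradiction (Branch-disjoint (proj₁ (P-elim Pb)) (proj₁ (Other.P-elim Qb))) s≢t
      ... | true  | false = refl
      ... | false | true  = refl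
      ... | false | false = sym (+-identityʳ _)

    via-ct : ∀ {b} → Q b ≡ true → dist G (c s) b ≡ δ + dist G (c t) b
    via-ct {b} Qb = begin
      dist G (c s) b                        ≡⟨ dist-sym sym-G (c s) b ⟩
      dist G b (c s)                        ≡⟨ dist-through-gate Other.P-gate Qb (proj₂ (connected b (c s))) (Other.P-cycle s≢t) ⟩
      dist G b (c t) + dist G (c t) (c s)   ≡⟨ +-comm (dist G b (c t)) _ ⟩
      dist G (c t) (c s) + dist G b (c t)   ≡⟨ cong₂ _+_ (dist-sym sym-G (c t) (c s)) (dist-sym sym-G b (c t)) ⟩
      δ + dist G (c t) b                    ∎
      where open ≡-Reasoning

    from-cs : sum (λ b → if Q b then dist G (c s) b else 0) ≡ card Q * δ + σ
    from-cs = trans (sum-cong-≗ pointwise) (trans (∑-distrib-+ {n} _ _) (cong (_+ σ) (sum-if-card Q δ)))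
      where
      pointwise : ∀ b → (if Q b then dist G (c s) b else 0) ≡ (if Q b then δ else 0) + (if Q b then dist G (c t) b else 0)
      pointwise b with Q b in Qb
      ... | true  = via-ct Qb
      ... | false = refl

    W-transplant : W H′ + card P * (rest (c s) + (card Q * δ + σ)) ≡ W G + card P * (rest (c t) + σ)
    W-transplant = begin
      W H′ + card P * (rest (c s) + (card Q * δ + σ))  ≡⟨ cong (λ X → W H′ + card P * X) from-outside ⟨
      W H′ + card P * outsideDist (c s)                ≡⟨ W-moveAt ⟩
      W G + card P * outsideDist (c t)                 ≡⟨ cong (λ X → W G + card P * X) (outside-split (c t)) ⟩
      W G + card P * (rest (c t) + σ)                  ∎
      where
      open ≡-Reasoning
      from-outside : outsideDist (c s) ≡ rest (c s) + (card Q * δ + σ)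
      from-outside = trans (outside-split (c s)) (cong (rest (c s) +_) from-cs)

    shift-positive : 3 ≤ branchSize G c t → 1 ≤ card Q * δ
    shift-positive big = *-mono-≤ (Other.P-nonempty big) (n≢0⇒n>0 (cs≢ct ∘ dist≡0⇒≡ (proj₂ (connected (c s) (c t)))))

decrease : ∀ {w w₀ k a b m σ : ℕ} →
  w + k * (a + (m + σ)) ≡ w₀ + k * (b + σ) → b ≤ a → 1 ≤ k → 1 ≤ m → w < w₀
decrease {w} {w₀} {k} {a} {b} {m} {σ} eq b≤a 1≤k 1≤m = +-cancelʳ-< (k * (b + σ)) w w₀ (begin-strict
  w + k * (b + σ)        <⟨ +-monoʳ-< w (*-monoʳ-< k ⦃ >-nonZero 1≤k ⦄ (+-mono-≤-< b≤a (+-monoˡ-≤ σ 1≤m))) ⟩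
  w + k * (a + (m + σ))  ≡⟨ eq ⟩
  w₀ + k * (b + σ)       ∎)
  where open ≤-Reasoning

lemma2p6 : ∀ {n g : ℕ} (G : Graph n) (c : Fin g → Fin n) (p q : Fin g) (x y : Fin n)
    → Unicyclic G c
    → p ≢ q
    → 3 ≤ branchSize G c p
    → 3 ≤ branchSize G c q
    → LeafAt G c p x
    → LeafAt G c q y
    → (∀ k → IsMatchingNumber G k
         → IsMatchingNumber (G₁ G c p q x y) k × IsMatchingNumber (G₂ G c p q x y) k)
      × (W (G₁ G c p q x y) ⊓ W (G₂ G c p q x y) < W G)
lemma2p6 G c p q x y U p≢q big-p big-q leaf-x leaf-y = (λ k ν → T₁.matching ν , T₂.matching ν) , smaller
  where
  open UnicyclicGraph G c U
  module T₁ = Transplant (p≢q ∘ sym) leaf-y leaf-x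
  module T₂ = Transplant p≢q leaf-x leaf-y

  rests-agree : ∀ u → T₁.rest u ≡ T₂.rest u
  rests-agree u = sum-cong-≗ (λ b → cong (if_then 0 else dist G u b) (∨-comm (T₁.P b) (T₂.P b)))

  smaller : W (G₁ G c p q x y) ⊓ W (G₂ G c p q x y) < W G
  smaller with ≤-total (T₂.rest (c q)) (T₂.rest (c p))
  ... | inj₁ β≤α = m<n⇒o⊓m<n _ (decrease T₂.W-transplant β≤α (T₂.P-nonempty big-p) (T₂.shift-positive big-q))
  ... | inj₂ α≤β = m<n⇒m⊓o<n _ (decrease T₁.W-transplant α′≤β′ (T₁.P-nonempty big-q) (T₁.shift-positive big-p))
    where
    α′≤β′ : T₁.rest (c p) ≤ T₁.rest (c q)
    α′≤β′ = subst₂ _≤_ (sym (rests-agree (c p))) (sym (rests-agree (c q))) α≤β
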